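{- Let $\ell\in\mathbb{N}$. Then $|\mathcal{J}(1,\ell)_n|=O(F_{n,\ell})$ as $n\to\infty$, where $\mathcal{J}(1,\ell)_n$ is the set of ordered graphs in $\mathcal{J}(1,\ell)$ with vertex set $[n]$.
   Context: An ordered graph of order $n$ is a graph on vertex set $[n]$ with the natural order; $A\leqslant B$ means $A$ is an induced ordered subgraph of $B$. For ordered graphs $G_1,\dots,G_m$ of orders $n_1,\dots,n_m$ with $N_i=n_1+\cdots+n_i$, $G_1+\cdots+G_m$ has vertex set $[N_m]$ with a copy of $G_i$ on $[N_{i-1}+1,N_i]$ and no edges between different intervals. For $n\in\mathbb{N}$: $J^{(n)}_1=K_n$; $J^{(n)}_2$ on $[n]$ has edge set $\{1n\}$ (empty if $n=1$); $J^{(n)}_3$ has edge set $\{1i:i\in[2,n]\}$; $J^{(n)}_4$ has edge set $\{in:i\in[n-1]\}$; $L^{(n)}$ has edge set $\{i(i+1):i\in[n-1]\}$; $Q_1$ on $[4]$ has edges $\{13,24\}$; $Q_2$ on $[4]$ has edges $\{14,23\}$. $\mathcal{J}_\ell=\{J^{(n)}_i:i\in[4],n\leqslant\ell\}\cup\{L^{(n)}:n\leqslant\ell\}$ for $\ell\le3$, additionally including $Q_1,Q_2$ for $\ell\geqslant4$. $G\in\mathcal{J}(k,\ell)$ iff there are $s\leqslant k$ ordered graphs $A_1,\dots,A_s$ with $G=A_1+\cdots+A_s$ such that each $A_i=B^{(i)}_1+\cdots+B^{(i)}_{t(i)}$ with every $B^{(i)}_j\in\mathcal{J}_\ell$ and,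 for all $j,j'$, $B^{(i)}_j\leqslant B^{(i)}_{j'}$ or $B^{(i)}_{j'}\leqslant B^{(i)}_j$. $F_{n,\ell}=0$ for $n<0$, $F_{0,\ell}=1$, $F_{n,\ell}=F_{n-1,\ell}+\cdots+F_{n-\ell,\ell}$ for $n\ge1$. -}

module Defs where

open import Data.Nat using (ℕ; zero; suc; _+_; _*_; _∸_; _≤_; _<_; _≥_; _≡ᵇ_; _<ᵇ_)
open import Data.Bool using (Bool; true; false; _∧_; not; if_then_else_)
open import Data.List using (List; []; _∷_; foldr; map; length; take)
open import Data.Nat.ListAction using (sum)
open import Data.List.Relation.Unary.All using (All)
open import Data.List.Relation.Unary.AllPairs using (AllPairs)
open import Data.Product using (Σ; _×_; _,_; ∃)
open import Data.Sum using (_⊎_)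
open import Relation.Binary.PropositionalEquality using (_≡_)
open import Relation.Nullary using (¬_)

-- Vertices are 0,…,ord-1 (vertex k here is
-- vertex k+1 of the paper).  `edge i j` is only meaningful for i < j < ord;
-- it says whether {i,j} is an edge.  Values outside that range are ignored.
record OGraph : Set where
  constructor mkG
  field
    ord  : ℕ
    edge : ℕ → ℕ → Bool
open OGraph public

_≈_ : OGraph → OGraph → Set
G ≈ H = (ord G ≡ ord H) ×
        (∀ i j → i < j → j < ord G → edge G i j ≡ edge H i j)

_⩽_ : OGraph → OGraph → Set
A ⩽ B = Σ (ℕ → ℕ) λ f →
          (∀ i → i < ord A → f i < ord B) ×
          (∀ i j → i < j → j < ord A → f i < f j) ×
          (∀ i j → i < j → j < ord A → edge A i j ≡ edge B (f i) (f j))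

_⊕_ : OGraph → OGraph → OGraph
A ⊕ B = mkG (ord A + ord B) e
  where
    m = ord A
    e : ℕ → ℕ → Bool
    e i j = if (i <ᵇ m) ∧ (j <ᵇ m) then edge A i j
            else if not (i <ᵇ m) ∧ not (j <ᵇ m) then edge B (i ∸ m) (j ∸ m)
            else false

∅G : OGraph
∅G = mkG 0 (λ _ _ → false)

sumG : List OGraph → OGraph
sumG = foldr _⊕_ ∅G

Kn : ℕ → OGraph
Kn n = mkG n (λ _ _ → true)

J2 : ℕ → OGraph
J2 n = mkG n (λ i j → (i ≡ᵇ 0) ∧ (j ≡ᵇ (n ∸ 1)))

J3 : ℕ → OGraph
J3 n = mkG n (λ i j → i ≡ᵇ 0)

J4 : ℕ → OGraph
J4 n = mkG n (λ i j → j ≡ᵇ (n ∸ 1))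

Ln : ℕ → OGraph
Ln n = mkG n (λ i j → j ≡ᵇ suc i)

Q1 : OGraph
Q1 = mkG 4 (λ i j → ((i ≡ᵇ 0) ∧ (j ≡ᵇ 2)) Data.Bool.∨ ((i ≡ᵇ 1) ∧ (j ≡ᵇ 3)))

Q2 : OGraph
Q2 = mkG 4 (λ i j → ((i ≡ᵇ 0) ∧ (j ≡ᵇ 3)) Data.Bool.∨ ((i ≡ᵇ 1) ∧ (j ≡ᵇ 2)))

data Basic (ℓ : ℕ) : OGraph → Set where
  bK  : ∀ n → 1 ≤ n → n ≤ ℓ → Basic ℓ (Kn n)
  bJ2 : ∀ n → 1 ≤ n → n ≤ ℓ → Basic ℓ (J2 n)
  bJ3 : ∀ n → 1 ≤ n → n ≤ ℓ → Basic ℓ (J3 n)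
  bJ4 : ∀ n → 1 ≤ n → n ≤ ℓ → Basic ℓ (J4 n)
  bL  : ∀ n → 1 ≤ n → n ≤ ℓ → Basic ℓ (Ln n)
  bQ1 : 4 ≤ ℓ → Basic ℓ Q1
  bQ2 : 4 ≤ ℓ → Basic ℓ Q2

Chain : ℕ → List OGraph → Set
Chain ℓ Bs = All (Basic ℓ) Bs ×
             All (λ B → All (λ B' → (B ⩽ B') ⊎ (B' ⩽ B)) Bs) Bs

InJ : ℕ → ℕ → OGraph → Set
InJ k ℓ G = Σ (List (List OGraph)) λ Bss →
              (length Bss ≤ k) × All (Chain ℓ) Bss ×
              (G ≈ sumG (map sumG Bss))

-- Fs ℓ n = [F_{n,ℓ}, F_{n-1,ℓ}, …, F_{0,ℓ}]
Fs : ℕ → ℕ → List ℕ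
Fs ℓ zero    = 1 ∷ []
Fs ℓ (suc n) = sum (take ℓ (Fs ℓ n)) ∷ Fs ℓ n

F : ℕ → ℕ → ℕ
F n ℓ = sum (take 1 (Fs ℓ n))

-- |S| ≤ c for S = {G of order n : P G} (graphs counted up to ≈):
-- every list of pairwise distinct such graphs has length ≤ c.
CardLe : (OGraph → Set) → ℕ → ℕ → Set
CardLe P n c = ∀ (gs : List OGraph) →
               All (λ G → (ord G ≡ n) × P G) gs →
               AllPairs (λ G H → ¬ (G ≈ H)) gs →
               length gs ≤ c

-- A graph G = B₁ + ⋯ + B_t of 𝒥(1,ℓ) is a sum of members of 𝒥_ℓ forming a chain
-- under ⩽.  An embedding between ordered graphs of the same order is the identity,
-- so members of the chain with equal order coincide.  Hence G is determined by the
-- composition (ord B₁, …, ord B_t) of n into parts in [1,ℓ], of which there are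
-- F_{n,ℓ}, together with a choice, for each order m ≤ ℓ, of one of the seven shapes
-- in 𝒥_ℓ.  This gives |𝒥(1,ℓ)_n| ≤ 7^{ℓ+1} F_{n,ℓ}.
module Submission where

open import Defs
open import Data.Bool using (true; false; T)
open import Data.Empty using (⊥-elim)
open import Data.List using (List; []; _∷_; map; length; take; _++_; applyUpTo; cartesianProduct; cartesianProductWith)
open import Data.List.Properties using (length-map; length-++; take-map; length-removeAt′)
open import Data.List.Membership.Propositional using (_∈_; lose)
open import Data.List.Membership.Propositional.Properties using (∈-map⁺; ∈-++⁺ˡ; ∈-++⁺ʳ; ∈-cartesianProductWith⁺; ∈-cartesianProduct⁺)
open import Data.List.Relation.Unary.All as All using (All; []; _∷_)
open import Data.List.Relation.Unary.All.Properties using (map⁺)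
open import Data.List.Relation.Unary.Any using (Any; here; there; _─_)
open import Data.List.Relation.Unary.AllPairs using (AllPairs; []; _∷_)
open import Data.Nat using (ℕ; zero; suc; _+_; _*_; _∸_; _^_; _≤_; _<_; _≥_; _<ᵇ_; z≤n; s≤s; s≤s⁻¹; _≟_)
open import Data.Nat.ListAction using (sum)
open import Data.Nat.Properties
open import Data.Product using (Σ; ∃; _×_; _,_; proj₁; proj₂)
open import Data.Sum using (_⊎_; inj₁; inj₂)
open import Data.Unit using (tt)
open import Relation.Binary.PropositionalEquality
open import Relation.Nullary using (¬_; yes; no)

private
  variable
    A X : Set

≈-refl : ∀ {G} → G ≈ G
≈-refl = refl , λ _ _ _ _ → refl

≈-sym : ∀ {G H} → G ≈ H → H ≈ G
≈-sym {mkG _ _} {mkG _ _} (refl , same) = refl , λ i j i<j j<n → sym (same i j i<j j<n)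

≈-trans : ∀ {G H K} → G ≈ H → H ≈ K → G ≈ K
≈-trans {mkG _ _} {mkG _ _} {mkG _ _} (refl , same) (refl , same′) =
  refl , λ i j i<j j<n → trans (same i j i<j j<n) (same′ i j i<j j<n)

<ᵇ≡true⇒< : ∀ {m n} → (m <ᵇ n) ≡ true → m < n
<ᵇ≡true⇒< {m} {n} eq = <ᵇ⇒< m n (subst T (sym eq) tt)

<ᵇ≡false⇒≥ : ∀ {m n} → (m <ᵇ n) ≡ false → n ≤ m
<ᵇ≡false⇒≥ eq = ≮⇒≥ λ m<n → subst T eq (<⇒<ᵇ m<n)

⊕-cong : ∀ {G G′ H H′} → G ≈ G′ → H ≈ H′ → (G ⊕ H) ≈ (G′ ⊕ H′)
⊕-cong {mkG a e} {mkG _ e′} {mkG b f} {mkG _ f′} (refl , sameG) (refl , sameH) = refl , same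
  where
  same : ∀ i j → i < j → j < a + b → edge (mkG a e ⊕ mkG b f) i j ≡ edge (mkG a e′ ⊕ mkG b f′) i j
  same i j i<j j<a+b with i <ᵇ a in i<ᵇa | j <ᵇ a in j<ᵇa
  ... | true  | true  = sameG i j i<j (<ᵇ≡true⇒< j<ᵇa)
  ... | true  | false = refl
  ... | false | true  = refl
  ... | false | false =
    sameH (i ∸ a) (j ∸ a) (∸-monoˡ-< i<j (<ᵇ≡false⇒≥ {i} {a} i<ᵇa))
          (subst (j ∸ a <_) (m+n∸m≡n a b) (∸-monoˡ-< j<a+b (<ᵇ≡false⇒≥ {j} {a} j<ᵇa)))

ord-sumG : ∀ Bs → ord (sumG Bs) ≡ sum (map ord Bs)
ord-sumG []       = refl
ord-sumG (B ∷ Bs) = cong (ord B +_) (ord-sumG Bs)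

sumG-cong-ord : (g : ℕ → OGraph) {Bs : List OGraph} →
                All (λ B → B ≈ g (ord B)) Bs → sumG Bs ≈ sumG (map g (map ord Bs))
sumG-cong-ord g []       = ≈-refl
sumG-cong-ord g (B≈ ∷ Bs≈) = ⊕-cong B≈ (sumG-cong-ord g Bs≈)

module StrictlyIncreasingEndomap {n : ℕ} (f : ℕ → ℕ)
  (f<n : ∀ i → i < n → f i < n)
  (f-strict : ∀ i j → i < j → j < n → f i < f j) where

  i≤f[i] : ∀ i → i < n → i ≤ f i
  i≤f[i] zero    _       = z≤n
  i≤f[i] (suc i) 1+i<n = ≤-trans (s≤s (i≤f[i] i (<⇒≤ 1+i<n))) (f-strict i (suc i) ≤-refl 1+i<n)

  k+f[i]<n : ∀ k i → k + i < n → k + f i < n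
  k+f[i]<n zero    i i<n     = f<n i i<n
  k+f[i]<n (suc k) i 1+k+i<n = begin-strict
    suc k + f i       ≡⟨ sym (+-suc k (f i)) ⟩
    k + suc (f i)     ≤⟨ +-monoʳ-≤ k (f-strict i (suc i) ≤-refl (≤-<-trans (s≤s (m≤n+m i k)) 1+k+i<n)) ⟩
    k + f (suc i)     <⟨ k+f[i]<n k (suc i) k+1+i<n ⟩
    n                 ∎
    where
    open ≤-Reasoning
    k+1+i<n : k + suc i < n
    k+1+i<n = subst (_< n) (sym (+-suc k i)) 1+k+i<n

  f≗id : ∀ i → i < n → f i ≡ i
  f≗id i i<n = ≤-antisym (s≤s⁻¹ (+-cancelˡ-< k (f i) (suc i) k+f[i]<k+1+i)) (i≤f[i] i i<n)
    where
    k = n ∸ suc i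
    k+1+i≡n : k + suc i ≡ n
    k+1+i≡n = m∸n+n≡m i<n
    k+f[i]<k+1+i : k + f i < k + suc i
    k+f[i]<k+1+i = subst (k + f i <_) (sym k+1+i≡n)
      (k+f[i]<n k i (subst (k + i <_) k+1+i≡n (+-monoʳ-< k ≤-refl)))

⩽∧ord≡⇒≈ : ∀ {G H} → G ⩽ H → ord G ≡ ord H → G ≈ H
⩽∧ord≡⇒≈ {mkG n e} {mkG _ e′} (f , f<n , f-strict , f-edge) refl = refl , same
  where
  open StrictlyIncreasingEndomap f f<n f-strict
  same : ∀ i j → i < j → j < n → e i j ≡ e′ i j
  same i j i<j j<n rewrite f-edge i j i<j j<n | f≗id i (<-trans i<j j<n) | f≗id j j<n = refl

lookupOr : A → List A → ℕ → A
lookupOr d []       _       = d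
lookupOr d (x ∷ xs) zero    = x
lookupOr d (x ∷ xs) (suc i) = lookupOr d xs i

lookupOr-take : ∀ (d : A) xs {i k} → i < k → lookupOr d (take k xs) i ≡ lookupOr d xs i
lookupOr-take d []       {k = suc k} _       = refl
lookupOr-take d (x ∷ xs) {zero}  {suc k} _       = refl
lookupOr-take d (x ∷ xs) {suc i} {suc k} (s≤s i<k) = lookupOr-take d xs i<k

lookupOr-applyUpTo : ∀ (d : A) f {i} k → i < k → lookupOr d (applyUpTo f k) i ≡ f i
lookupOr-applyUpTo d f {zero}  (suc k) _         = refl
lookupOr-applyUpTo d f {suc i} (suc k) (s≤s i<k) = lookupOr-applyUpTo d (λ m → f (suc m)) k i<k

length-cartesianProductWith : ∀ {B C : Set} (f : A → B → C) xs ys →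
  length (cartesianProductWith f xs ys) ≡ length xs * length ys
length-cartesianProductWith f []       ys = refl
length-cartesianProductWith f (x ∷ xs) ys = begin
  length (map (f x) ys ++ cartesianProductWith f xs ys)     ≡⟨ length-++ (map (f x) ys) ⟩
  length (map (f x) ys) + length (cartesianProductWith f xs ys)
    ≡⟨ cong₂ _+_ (length-map (f x) ys) (length-cartesianProductWith f xs ys) ⟩
  length ys + length xs * length ys                         ∎
  where open ≡-Reasoning

words : ℕ → List A → List (List A)
words zero    xs = [] ∷ []
words (suc k) xs = cartesianProductWith _∷_ xs (words k xs)

length-words : ∀ k (xs : List A) → length (words k xs) ≡ length xs ^ k
length-words zero    xs = refl
length-words (suc k) xs =
  trans (length-cartesianProductWith _∷_ xs (words k xs)) (cong (length xs *_) (length-words k xs))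

applyUpTo∈words : ∀ {xs : List A} {f} → (∀ i → f i ∈ xs) → ∀ k → applyUpTo f k ∈ words k xs
applyUpTo∈words f∈ zero    = here refl
applyUpTo∈words f∈ (suc k) = ∈-cartesianProductWith⁺ _∷_ (f∈ 0) (applyUpTo∈words (λ i → f∈ (suc i)) k)

prependParts : ℕ → List (List (List ℕ)) → List (List ℕ)
prependParts k []           = []
prependParts k (css ∷ csss) = map (k ∷_) css ++ prependParts (suc k) csss

length-prependParts : ∀ k csss → length (prependParts k csss) ≡ sum (map length csss)
length-prependParts k []           = refl
length-prependParts k (css ∷ csss) = begin
  length (map (k ∷_) css ++ prependParts (suc k) csss)          ≡⟨ length-++ (map (k ∷_) css) ⟩
  length (map (k ∷_) css) + length (prependParts (suc k) csss)
    ≡⟨ cong₂ _+_ (length-map (k ∷_) css) (length-prependParts (suc k) csss) ⟩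
  length css + sum (map length csss)                             ∎
  where open ≡-Reasoning

∈-prependParts : ∀ k j csss {cs} → cs ∈ lookupOr [] csss j → (k + j ∷ cs) ∈ prependParts k csss
∈-prependParts k zero    (css ∷ csss) {cs} cs∈ =
  ∈-++⁺ˡ (subst (λ m → (m ∷ cs) ∈ map (k ∷_) css) (sym (+-identityʳ k)) (∈-map⁺ (k ∷_) cs∈))
∈-prependParts k (suc j) (css ∷ csss) {cs} cs∈ =
  ∈-++⁺ʳ (map (k ∷_) css)
    (subst (λ m → (m ∷ cs) ∈ prependParts (suc k) csss) (sym (+-suc k j)) (∈-prependParts (suc k) j csss cs∈))

module Compositions (ℓ : ℕ) where

  -- table n = [C n, C (n-1), …, C 0] mirrors Fs ℓ n, where C m lists the
  -- compositions of m into parts in [1,ℓ]; C (n+1) is read off the first ℓ entries.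
  table : ℕ → List (List (List ℕ))
  table zero    = ([] ∷ []) ∷ []
  table (suc n) = prependParts 1 (take ℓ (table n)) ∷ table n

  compositions : ℕ → List (List ℕ)
  compositions n = lookupOr [] (table n) 0

  map-length-table : ∀ n → map length (table n) ≡ Fs ℓ n
  map-length-table zero    = refl
  map-length-table (suc n) = cong₂ _∷_ head-length (map-length-table n)
    where
    open ≡-Reasoning
    head-length : length (prependParts 1 (take ℓ (table n))) ≡ sum (take ℓ (Fs ℓ n))
    head-length = begin
      length (prependParts 1 (take ℓ (table n)))   ≡⟨ length-prependParts 1 (take ℓ (table n)) ⟩
      sum (map length (take ℓ (table n)))          ≡⟨ cong sum (sym (take-map ℓ (table n))) ⟩
      sum (take ℓ (map length (table n)))          ≡⟨ cong (λ xs → sum (take ℓ xs)) (map-length-table n) ⟩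
      sum (take ℓ (Fs ℓ n))                        ∎

  length-compositions : ∀ n → length (compositions n) ≡ F n ℓ
  length-compositions zero    = refl
  length-compositions (suc n) =
    trans (sym (+-identityʳ _)) (cong (λ xs → sum (take 1 xs)) (map-length-table (suc n)))

  lookupOr-table : ∀ k m → lookupOr [] (table (k + m)) k ≡ compositions m
  lookupOr-table zero    m = refl
  lookupOr-table (suc k) m = lookupOr-table k m

  ∈-compositions : ∀ {cs} → All (λ k → 1 ≤ k × k ≤ ℓ) cs → cs ∈ compositions (sum cs)
  ∈-compositions {[]}         []                 = here refl
  ∈-compositions {zero ∷ _}   ((() , _) ∷ _)
  ∈-compositions {suc k ∷ cs} ((_ , k<ℓ) ∷ valid) =
    ∈-prependParts 1 k (take ℓ (table (k + sum cs))) (subst (cs ∈_) table-entry (∈-compositions valid))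
    where
    table-entry : compositions (sum cs) ≡ lookupOr [] (take ℓ (table (k + sum cs))) k
    table-entry = sym (trans (lookupOr-take [] (table (k + sum cs)) k<ℓ) (lookupOr-table k (sum cs)))

data Shape : Set where
  K J₂ J₃ J₄ L Q₁ Q₂ : Shape

shapeGraph : Shape → ℕ → OGraph
shapeGraph K  n = Kn n
shapeGraph J₂ n = J2 n
shapeGraph J₃ n = J3 n
shapeGraph J₄ n = J4 n
shapeGraph L  n = Ln n
shapeGraph Q₁ _ = Q1
shapeGraph Q₂ _ = Q2

allShapes : List Shape
allShapes = K ∷ J₂ ∷ J₃ ∷ J₄ ∷ L ∷ Q₁ ∷ Q₂ ∷ []

∈-allShapes : ∀ s → s ∈ allShapes
∈-allShapes K  = here refl
∈-allShapes J₂ = there (here refl)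
∈-allShapes J₃ = there (there (here refl))
∈-allShapes J₄ = there (there (there (here refl)))
∈-allShapes L  = there (there (there (there (here refl))))
∈-allShapes Q₁ = there (there (there (there (there (here refl)))))
∈-allShapes Q₂ = there (there (there (there (there (there (here refl))))))

module _ {ℓ : ℕ} where

  shapeOf : ∀ {B} → Basic ℓ B → Shape
  shapeOf (bK _ _ _)  = K
  shapeOf (bJ2 _ _ _) = J₂
  shapeOf (bJ3 _ _ _) = J₃
  shapeOf (bJ4 _ _ _) = J₄
  shapeOf (bL _ _ _)  = L
  shapeOf (bQ1 _)     = Q₁
  shapeOf (bQ2 _)     = Q₂

  shapeGraph-shapeOf : ∀ {B} (b : Basic ℓ B) → shapeGraph (shapeOf b) (ord B) ≡ B
  shapeGraph-shapeOf (bK _ _ _)  = refl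
  shapeGraph-shapeOf (bJ2 _ _ _) = refl
  shapeGraph-shapeOf (bJ3 _ _ _) = refl
  shapeGraph-shapeOf (bJ4 _ _ _) = refl
  shapeGraph-shapeOf (bL _ _ _)  = refl
  shapeGraph-shapeOf (bQ1 _)     = refl
  shapeGraph-shapeOf (bQ2 _)     = refl

  basic-ord : ∀ {B} → Basic ℓ B → 1 ≤ ord B × ord B ≤ ℓ
  basic-ord (bK _ 1≤n n≤ℓ)  = 1≤n , n≤ℓ
  basic-ord (bJ2 _ 1≤n n≤ℓ) = 1≤n , n≤ℓ
  basic-ord (bJ3 _ 1≤n n≤ℓ) = 1≤n , n≤ℓ
  basic-ord (bJ4 _ 1≤n n≤ℓ) = 1≤n , n≤ℓ
  basic-ord (bL _ 1≤n n≤ℓ)  = 1≤n , n≤ℓ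
  basic-ord (bQ1 4≤ℓ)       = s≤s z≤n , 4≤ℓ
  basic-ord (bQ2 4≤ℓ)       = s≤s z≤n , 4≤ℓ

  -- K when no member has order m.
  shapeOfOrder : ℕ → (Bs : List OGraph) → All (Basic ℓ) Bs → Shape
  shapeOfOrder m []       []       = K
  shapeOfOrder m (B ∷ Bs) (b ∷ bs) with ord B ≟ m
  ... | yes _ = shapeOf b
  ... | no  _ = shapeOfOrder m Bs bs

  shapeOfOrder-member : ∀ {B} Bs (bs : All (Basic ℓ) Bs) → B ∈ Bs →
    ∃ λ B′ → B′ ∈ Bs × ord B′ ≡ ord B × shapeGraph (shapeOfOrder (ord B) Bs bs) (ord B) ≡ B′
  shapeOfOrder-member {B} (B′ ∷ Bs) (b ∷ bs) B∈ with ord B′ ≟ ord B | B∈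
  ... | yes ord≡ | _ = B′ , here refl , ord≡ , subst (λ m → shapeGraph (shapeOf b) m ≡ B′) ord≡ (shapeGraph-shapeOf b)
  ... | no  ord≢ | here refl = ⊥-elim (ord≢ refl)
  ... | no  _    | there B∈Bs with shapeOfOrder-member Bs bs B∈Bs
  ...   | B″ , B″∈ , ord≡ , B″≡ = B″ , there B″∈ , ord≡ , B″≡

  chain-member-≈ : ∀ {Bs} ((bs , comparable) : Chain ℓ Bs) {B} → B ∈ Bs →
    B ≈ shapeGraph (shapeOfOrder (ord B) Bs bs) (ord B)
  chain-member-≈ {Bs} (bs , comparable) B∈ with shapeOfOrder-member Bs bs B∈
  ... | B′ , B′∈ , ord≡ , refl with All.lookup (All.lookup comparable B∈) B′∈
  ...   | inj₁ B⩽B′ = ⩽∧ord≡⇒≈ B⩽B′ (sym ord≡)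
  ...   | inj₂ B′⩽B = ≈-sym (⩽∧ord≡⇒≈ B′⩽B ord≡)

  InJ₁⇒chain : ∀ {G} → InJ 1 ℓ G → ∃ λ Bs → Chain ℓ Bs × G ≈ sumG (sumG Bs ∷ [])
  InJ₁⇒chain ([]         , _       , []              , G≈) = [] , ([] , []) , ≈-trans G≈ (refl , λ _ _ _ ())
  InJ₁⇒chain ((Bs ∷ [])  , _       , (chain ∷ [])    , G≈) = Bs , chain , G≈
  InJ₁⇒chain ((_ ∷ _ ∷ _) , s≤s () , _               , _)

module Pigeonhole {Y : Set} (_∼_ : Y → Y → Set) (Codes : Y → X → Set)
  (coherent : ∀ {g h c} → Codes g c → Codes h c → g ∼ h) where

  ─-split : ∀ {g h} {cs : List X} (g∈ : Any (Codes g) cs) → Any (Codes h) cs →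
            (∃ λ c → Codes g c × Codes h c) ⊎ Any (Codes h) (cs ─ g∈)
  ─-split (here g∼c) (here h∼c) = inj₁ (_ , g∼c , h∼c)
  ─-split (here _)   (there h∈) = inj₂ h∈
  ─-split (there _)  (here h∼c) = inj₂ (here h∼c)
  ─-split (there g∈) (there h∈) with ─-split g∈ h∈
  ... | inj₁ shared = inj₁ shared
  ... | inj₂ h∈′    = inj₂ (there h∈′)

  length-≤-codes : ∀ gs → AllPairs (λ g h → ¬ g ∼ h) gs → (cs : List X) →
                   All (λ g → Any (Codes g) cs) gs → length gs ≤ length cs
  length-≤-codes []       _              cs _               = z≤n
  length-≤-codes (g ∷ gs) (g≁ ∷ distinct) cs (g∈ ∷ gs∈) =
    subst (suc (length gs) ≤_) (sym (length-removeAt′ cs _))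
      (s≤s (length-≤-codes gs distinct (cs ─ g∈) (remaining gs g≁ gs∈)))
    where
    remaining : ∀ hs → All (λ h → ¬ g ∼ h) hs → All (λ h → Any (Codes h) cs) hs →
                All (λ h → Any (Codes h) (cs ─ g∈)) hs
    remaining []       []         []           = []
    remaining (h ∷ hs) (g≁h ∷ g≁) (h∈ ∷ hs∈) with ─-split g∈ h∈
    ... | inj₁ (_ , g∼c , h∼c) = ⊥-elim (g≁h (coherent g∼c h∼c))
    ... | inj₂ h∈′             = h∈′ ∷ remaining hs g≁ hs∈

module Coding (ℓ : ℕ) where
  open Compositions ℓ

  -- A code (cs , ss) stands for the sum of the chain whose i-th member has order
  -- cs_i and shape ss_{cs_i}; ss assigns a shape to each order 0, …, ℓ.
  Code : Set
  Code = List ℕ × List Shape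

  decode : Code → OGraph
  decode (cs , ss) = sumG (sumG (map (λ m → shapeGraph (lookupOr K ss m) m) cs) ∷ [])

  codes : ℕ → List Code
  codes n = cartesianProduct (compositions n) (words (suc ℓ) allShapes)

  length-codes : ∀ n → length (codes n) ≡ F n ℓ * 7 ^ suc ℓ
  length-codes n =
    trans (length-cartesianProductWith _,_ (compositions n) (words (suc ℓ) allShapes))
          (cong₂ _*_ (length-compositions n) (length-words (suc ℓ) allShapes))

  InJ₁-coded : ∀ {G n} → ord G ≡ n → InJ 1 ℓ G → Any (λ c → G ≈ decode c) (codes n)
  InJ₁-coded {G} refl G∈ with InJ₁⇒chain G∈
  ... | Bs , chain@(bs , _) , G≈ = lose (∈-cartesianProduct⁺ orders∈ ss∈) (≈-trans G≈ (⊕-cong Bs≈ (≈-refl {∅G})))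
    where
    shapeAt : ℕ → Shape
    shapeAt m = shapeOfOrder m Bs bs
    ss = applyUpTo shapeAt (suc ℓ)
    g : ℕ → OGraph
    g m = shapeGraph (lookupOr K ss m) m

    sum-orders : sum (map ord Bs) ≡ ord G
    sum-orders = sym (trans (proj₁ G≈) (trans (+-identityʳ _) (ord-sumG Bs)))

    orders∈ : map ord Bs ∈ compositions (ord G)
    orders∈ = subst (λ n → map ord Bs ∈ compositions n) sum-orders
                (∈-compositions (map⁺ (All.map basic-ord bs)))

    ss∈ : ss ∈ words (suc ℓ) allShapes
    ss∈ = applyUpTo∈words {f = shapeAt} (λ m → ∈-allShapes (shapeAt m)) (suc ℓ)

    member≈ : ∀ {B} → B ∈ Bs → B ≈ g (ord B)
    member≈ {B} B∈ = subst (λ s → B ≈ shapeGraph s (ord B))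
      (sym (lookupOr-applyUpTo K shapeAt (suc ℓ) (s≤s (proj₂ (basic-ord (All.lookup bs B∈))))))
      (chain-member-≈ chain B∈)

    Bs≈ : sumG Bs ≈ sumG (map g (map ord Bs))
    Bs≈ = sumG-cong-ord g (All.tabulate member≈)

lemma7p2 : (ℓ : ℕ) → Σ ℕ λ C → Σ ℕ λ N → (n : ℕ) → n ≥ N → CardLe (InJ 1 ℓ) n (C * F n ℓ)
lemma7p2 ℓ = 7 ^ suc ℓ , 0 , λ n _ gs members distinct → begin
  length gs            ≤⟨ length-≤-codes gs distinct (codes n)
                            (All.map (λ (ord≡ , G∈) → InJ₁-coded ord≡ G∈) members) ⟩
  length (codes n)     ≡⟨ length-codes n ⟩
  F n ℓ * 7 ^ suc ℓ    ≡⟨ *-comm (F n ℓ) (7 ^ suc ℓ) ⟩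
  7 ^ suc ℓ * F n ℓ    ∎
  where
  open Coding ℓ
  open Pigeonhole _≈_ (λ G c → G ≈ decode c) (λ G≈ H≈ → ≈-trans G≈ (≈-sym H≈))
  open ≤-Reasoning
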